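{- For integers $n\ge1$ and $q\ge0$, \[ \sum_{\substack{r+s=n\\ r,s\ge0}}\ \sum_{\substack{\alpha_1+\cdots+\alpha_{r+1}=q\\ \alpha_i\ge0}}\eta(\alpha_1+1,\ldots,\alpha_r+1,\alpha_{r+1}+2,\{1\}^s)=\frac{P_{q+1}\bigl(H_n^{(1)},\ldots,H_n^{(q+1)}\bigr)}{n\cdot n!}. \]
   Context: For positive integers $\beta_1,\ldots,\beta_k$ with $\beta_1+\cdots+\beta_k>1$, $\eta(\beta_1,\ldots,\beta_k)=\sum_{n=1}^\infty\frac{1}{n^{\beta_1}(n+1)^{\beta_2}\cdots(n+k-1)^{\beta_k}}$. The notation $\{1\}^s$ denotes $s$ consecutive arguments equal to $1$. $H_n^{(m)}=\sum_{j=1}^n j^{ -m}$. The polynomials $P_m$ are defined by $\exp\bigl(\sum_{k\ge1}\frac{t_k}{k}z^k\bigr)=\sum_{m\ge0}P_m(t_1,\ldots,t_m)z^m$, i.e. $P_m(t_1,\ldots,t_m)=\sum_{k_1+2k_2+\cdots+mk_m=m,\,k_i\ge0}\prod_{i=1}^m\frac{1}{k_i!}\left(\frac{t_i}{i}\right)^{k_i}$. -}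

module Defs where

open import Data.Nat as ℕ using (ℕ; zero; suc; _≤ᵇ_)
open import Data.Integer using (+_)
open import Data.Rational using (ℚ; 0ℚ; 1ℚ; _+_; _*_; _-_; ∣_∣; _<_; _/_)
open import Data.List using (List; []; _∷_; map; concatMap; upTo; replicate; foldr)
open import Data.Bool using (if_then_else_)
open import Data.Product using (∃-syntax)

recip : ℕ → ℚ
recip j = + 1 / suc j

_^ℚ_ : ℚ → ℕ → ℚ
x ^ℚ zero = 1ℚ
x ^ℚ suc k = x * (x ^ℚ k)

invFact : ℕ → ℚ
invFact zero = 1ℚ
invFact (suc k) = recip k * invFact k

sumTo : ℕ → (ℕ → ℚ) → ℚ
sumTo zero f = 0ℚ
sumTo (suc N) f = sumTo N f + f N

sumList : List ℚ → ℚ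
sumList = foldr _+_ 0ℚ

-- Multiple series η(β₁,…,β_k) as the sequence of its partial sums.

-- etaTermFrom j (β₁ ∷ … ∷ β_k ∷ []) = 1 / ((j+1)^β₁ (j+2)^β₂ ⋯ (j+k)^β_k),
-- i.e. the summand of η at n = j+1.
etaTermFrom : ℕ → List ℕ → ℚ
etaTermFrom j [] = 1ℚ
etaTermFrom j (b ∷ bs) = (recip j ^ℚ b) * etaTermFrom (suc j) bs

etaPartial : List ℕ → ℕ → ℚ
etaPartial bs N = sumTo N (λ j → etaTermFrom j bs)

ConvergesTo : (ℕ → ℚ) → ℚ → Set
ConvergesTo a L = ∀ (ε : ℚ) → 0ℚ < ε → ∃[ N ] (∀ M → N ℕ.≤ M → ∣ a M - L ∣ < ε)

comps : ℕ → ℕ → List (List ℕ)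
comps zero zero = [] ∷ []
comps zero (suc q) = []
comps (suc k) q = concatMap (λ a → map (a ∷_) (comps k (q ℕ.∸ a))) (upTo (suc q))

etaArgs : List ℕ → ℕ → List ℕ
etaArgs [] s = replicate s 1
etaArgs (a ∷ []) s = suc (suc a) ∷ replicate s 1
etaArgs (a ∷ b ∷ rest) s = suc a ∷ etaArgs (b ∷ rest) s

lhsPartial : ℕ → ℕ → ℕ → ℚ
lhsPartial n q N =
  sumTo (suc n) (λ r →
    sumList (map (λ α → etaPartial (etaArgs α (n ℕ.∸ r)) N) (comps (suc r) q)))

H : ℕ → ℕ → ℚ
H n m = sumTo n (λ j → recip j ^ℚ m)

-- kvecs len st rem: all (k_st, …, k_{st+len-1}) with Σ i·k_i = rem
kvecs : ℕ → ℕ → ℕ → List (List ℕ)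
kvecs zero st zero = [] ∷ []
kvecs zero st (suc _) = []
kvecs (suc l) st rem =
  concatMap (λ k → if st ℕ.* k ≤ᵇ rem
                     then map (k ∷_) (kvecs l (suc st) (rem ℕ.∸ st ℕ.* k))
                     else [])
            (upTo (suc rem))

-- Π_{i} (1/k_i!) (t_i / i)^{k_i}, indices starting at st (st ≥ 1)
pTerm : (ℕ → ℚ) → ℕ → List ℕ → ℚ
pTerm t st [] = 1ℚ
pTerm t st (k ∷ ks) =
  invFact k * ((t st * recip (st ℕ.∸ 1)) ^ℚ k) * pTerm t (suc st) ks

-- P_m(t₁,…,t_m) = Σ_{k₁+2k₂+⋯+mk_m=m} Π_i (1/k_i!) (t_i/i)^{k_i}
-- (t is given as a function; only t 1, …, t m are used)
P : ℕ → (ℕ → ℚ) → ℚ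
P m t = sumList (map (pTerm t 1) (kvecs m 1 m))

module Submission where

-- Write y_j = 1/(j+1) and G_j(k, p) = Σ_{α₁+⋯+α_k = p} Π_i y_{j+i}^{αᵢ+1}, which equals
-- y_j ⋯ y_{j+k−1} · h_p(y_j, …, y_{j+k−1}). For fixed j the j-th summands of all the η-values in
-- the double sum add up to G_j(n+1, q+1): cutting a composition of q+1 into n+1 parts after its
-- last nonzero part produces exactly the argument lists (α₁+1, …, α_r+1, α_{r+1}+2, {1}^s).
-- The partial fraction 1/(j+1) − 1/(j+n+1) = n/((j+1)(j+n+1)) gives
-- n · G_j(n+1, p) = G_j(n, p) − G_{j+1}(n, p), so the sum over j telescopes to
-- G_0(n, q+1) / n = h_{q+1}(1, 1/2, …, 1/n) / (n · n!), up to a tail of size O(1/N).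
-- Finally h_{q+1} = P_{q+1}(p₁, …, p_{q+1}) for the power sums pᵢ = H_n^{(i)}: both satisfy
-- Newton's identities m·a_m = Σ_{i=1}^{m} pᵢ a_{m−i}.

open import Defs
open import Data.Nat as ℕ using (ℕ; zero; suc; _∸_; _≤_; _<_; _≤ᵇ_; s≤s; z≤n)
import Data.Nat.Properties as ℕP
open import Data.Nat.Induction using (<-rec)
open import Data.Nat.Coprimality using (1-coprimeTo)
import Data.Integer as ℤ
import Data.Integer.Properties as ℤP
open import Data.Rational as ℚ using (ℚ; mkℚ; 0ℚ; 1ℚ; _+_; _*_; _-_; _/_; ∣_∣; toℚᵘ; positive; nonNegative; *≤*)
import Data.Rational.Properties as ℚP
open import Data.Rational.Unnormalised using (mkℚᵘ; *≡*; *<*; _≃_)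
import Data.Rational.Unnormalised.Properties as ℚᵘP
open import Data.Rational.Solver using (module +-*-Solver)
open +-*-Solver using (solve; _:+_; _:-_; :-_; _:*_; _:=_; con)
open import Data.List using (List; []; _∷_; map; concatMap; upTo; applyUpTo; _++_; replicate)
import Data.List.Properties as ListP
open import Data.Bool using (Bool; true; false; T; if_then_else_)
open import Data.Empty using (⊥-elim)
open import Data.Product using (∃-syntax; _,_)
open import Relation.Nullary using (¬_)
open import Function using (_∘_)
open import Relation.Binary.PropositionalEquality
open ≡-Reasoning

module _ where
  open import Data.Integer using (+_; -[1+_]; +[1+_])

  fromℕ : ℕ → ℚ
  fromℕ n = + n / 1

  private
    toℚᵘ-fromℕ : ∀ n → toℚᵘ (fromℕ n) ≃ mkℚᵘ (+ n) 0
    toℚᵘ-fromℕ n = ℚP.toℚᵘ-fromℚᵘ (mkℚᵘ (+ n) 0)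

  fromℕ-+ : ∀ m n → fromℕ (m ℕ.+ n) ≡ fromℕ m + fromℕ n
  fromℕ-+ m n = ℚP.toℚᵘ-injective (ℚᵘP.≃-trans (toℚᵘ-fromℕ (m ℕ.+ n)) (ℚᵘP.≃-sym
    (ℚᵘP.≃-trans (ℚP.toℚᵘ-homo-+ (fromℕ m) (fromℕ n))
      (ℚᵘP.≃-trans (ℚᵘP.+-cong (toℚᵘ-fromℕ m) (toℚᵘ-fromℕ n)) (*≡* cross)))))
    where
    cross : (+ m ℤ.* + 1 ℤ.+ + n ℤ.* + 1) ℤ.* + 1 ≡ + (m ℕ.+ n) ℤ.* + 1
    cross rewrite ℤP.*-identityʳ (+ m) | ℤP.*-identityʳ (+ n) = refl

  fromℕ-* : ∀ m n → fromℕ (m ℕ.* n) ≡ fromℕ m * fromℕ n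
  fromℕ-* m n = ℚP.toℚᵘ-injective (ℚᵘP.≃-trans (toℚᵘ-fromℕ (m ℕ.* n)) (ℚᵘP.≃-sym
    (ℚᵘP.≃-trans (ℚP.toℚᵘ-homo-* (fromℕ m) (fromℕ n))
      (ℚᵘP.≃-trans (ℚᵘP.*-cong (toℚᵘ-fromℕ m) (toℚᵘ-fromℕ n)) (*≡* cross)))))
    where
    cross : (+ m ℤ.* + n) ℤ.* + 1 ≡ + (m ℕ.* n) ℤ.* + 1
    cross = cong (ℤ._* + 1) (sym (ℤP.pos-* m n))

  recip-*-fromℕ : ∀ j → recip j * fromℕ (suc j) ≡ 1ℚ
  recip-*-fromℕ j = ℚP.toℚᵘ-injective (ℚᵘP.≃-trans (ℚP.toℚᵘ-homo-* (recip j) (fromℕ (suc j)))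
    (ℚᵘP.≃-trans (ℚᵘP.*-cong (ℚP.toℚᵘ-fromℚᵘ (mkℚᵘ (+ 1) j)) (toℚᵘ-fromℕ (suc j))) (*≡* cross)))
    where
    cross : (+ 1 ℤ.* + suc j) ℤ.* + 1 ≡ + 1 ℤ.* + (suc j ℕ.* 1)
    cross = cong (λ k → + suc k) (trans (ℕP.*-identityʳ (j ℕ.+ 0)) (sym (cong (ℕ._+ 0) (ℕP.*-identityʳ j))))

  recip-cancel : ∀ r x → recip r * (fromℕ (suc r) * x) ≡ x
  recip-cancel r x = begin
    recip r * (fromℕ (suc r) * x)  ≡⟨ sym (ℚP.*-assoc (recip r) (fromℕ (suc r)) x) ⟩
    (recip r * fromℕ (suc r)) * x  ≡⟨ cong (_* x) (recip-*-fromℕ r) ⟩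
    1ℚ * x                         ≡⟨ ℚP.*-identityˡ x ⟩
    x                              ∎

  archimedean : ∀ (C ε : ℚ) → 0ℚ ℚ.< ε → ∃[ N ] (C ℚ.< ε * fromℕ (suc N))
  archimedean C (mkℚ (+ 0) _ _)    0<ε = ⊥-elim (ℤ.Positive.pos (positive 0<ε))
  archimedean C (mkℚ -[1+ _ ] _ _) 0<ε = ⊥-elim (ℤ.Positive.pos (positive 0<ε))
  archimedean (mkℚ c d _) ε@(mkℚ +[1+ e ] f _) _ =
    N , ℚP.toℚᵘ-cancel-< (ℚᵘP.<-respʳ-≃ (ℚᵘP.≃-sym (ℚᵘP.≃-trans (ℚP.toℚᵘ-homo-* ε (fromℕ (suc N)))
                                            (ℚᵘP.*-cong (ℚᵘP.≃-refl {toℚᵘ ε}) (toℚᵘ-fromℕ (suc N)))))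
                                        (*<* (cross c refl)))
    where
    N = ℤ.∣ c ∣ ℕ.* suc f
    cross : ∀ c′ → c′ ≡ c → c′ ℤ.* + suc (f ℕ.* 1) ℤ.< (+[1+ e ] ℤ.* +[1+ N ]) ℤ.* + suc d
    cross -[1+ _ ] _    = ℤ.-<+
    cross (+ c′)   refl = subst₂ ℤ._<_ (ℤP.pos-* c′ (suc (f ℕ.* 1)))
      (trans (ℤP.pos-* (suc e ℕ.* suc N) (suc d)) (cong (ℤ._* + suc d) (ℤP.pos-* (suc e) (suc N))))
      (ℤ.+<+ c′f<eNd)
      where
      c′f<eNd : c′ ℕ.* suc (f ℕ.* 1) ℕ.< suc e ℕ.* suc N ℕ.* suc d
      c′f<eNd rewrite ℕP.*-identityʳ f = ℕP.<-≤-trans (ℕP.n<1+n N)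
        (ℕP.≤-trans (ℕP.m≤n*m (suc N) (suc e)) (ℕP.m≤m*n (suc e ℕ.* suc N) (suc d)))

  recip≡mkℚ : ∀ j → recip j ≡ mkℚ (+ 1) j (1-coprimeTo (suc j))
  recip≡mkℚ j = ℚP.normalize-coprime (1-coprimeTo (suc j))

  recip-pos : ∀ j → 0ℚ ℚ.< recip j
  recip-pos j = subst (0ℚ ℚ.<_) (sym (recip≡mkℚ j)) (ℚP.positive⁻¹ (mkℚ (+ 1) j (1-coprimeTo (suc j))))

  recip-nonNeg : ∀ j → 0ℚ ℚ.≤ recip j
  recip-nonNeg j = ℚP.<⇒≤ (recip-pos j)

  recip-antitone : ∀ {i j} → i ℕ.≤ j → recip j ℚ.≤ recip i
  recip-antitone {i} {j} i≤j rewrite recip≡mkℚ i | recip≡mkℚ j =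
    *≤* (subst₂ ℤ._≤_ (sym (ℤP.*-identityˡ _)) (sym (ℤP.*-identityˡ _)) (ℤ.+≤+ (s≤s i≤j)))

sumTo-cong : ∀ N {f g : ℕ → ℚ} → (∀ i → f i ≡ g i) → sumTo N f ≡ sumTo N g
sumTo-cong zero    f≗g = refl
sumTo-cong (suc N) f≗g = cong₂ _+_ (sumTo-cong N f≗g) (f≗g N)

sumTo-cong-< : ∀ N {f g : ℕ → ℚ} → (∀ i → i ℕ.< N → f i ≡ g i) → sumTo N f ≡ sumTo N g
sumTo-cong-< zero    f≗g = refl
sumTo-cong-< (suc N) f≗g =
  cong₂ _+_ (sumTo-cong-< N (λ i i<N → f≗g i (ℕP.m≤n⇒m≤1+n i<N))) (f≗g N ℕP.≤-refl)

sumTo-zero : ∀ N → sumTo N (λ _ → 0ℚ) ≡ 0ℚ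
sumTo-zero zero    = refl
sumTo-zero (suc N) = trans (ℚP.+-identityʳ _) (sumTo-zero N)

sumTo-+ : ∀ N (f g : ℕ → ℚ) → sumTo N (λ i → f i + g i) ≡ sumTo N f + sumTo N g
sumTo-+ zero    f g = sym (ℚP.+-identityˡ 0ℚ)
sumTo-+ (suc N) f g = trans (cong (_+ (f N + g N)) (sumTo-+ N f g))
  (solve 4 (λ A B a b → (A :+ B) :+ (a :+ b) := (A :+ a) :+ (B :+ b)) refl
    (sumTo N f) (sumTo N g) (f N) (g N))

sumTo-*ˡ : ∀ N c (f : ℕ → ℚ) → c * sumTo N f ≡ sumTo N (λ i → c * f i)
sumTo-*ˡ zero    c f = ℚP.*-zeroʳ c
sumTo-*ˡ (suc N) c f =
  trans (ℚP.*-distribˡ-+ c (sumTo N f) (f N)) (cong (_+ c * f N) (sumTo-*ˡ N c f))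

sumTo-*ʳ : ∀ N c (f : ℕ → ℚ) → sumTo N f * c ≡ sumTo N (λ i → f i * c)
sumTo-*ʳ N c f = trans (ℚP.*-comm (sumTo N f) c)
  (trans (sumTo-*ˡ N c f) (sumTo-cong N (λ i → ℚP.*-comm c (f i))))

sumTo-suc : ∀ N (f : ℕ → ℚ) → sumTo (suc N) f ≡ f 0 + sumTo N (f ∘ suc)
sumTo-suc zero    f = trans (ℚP.+-identityˡ (f 0)) (sym (ℚP.+-identityʳ (f 0)))
sumTo-suc (suc N) f = trans (cong (_+ f (suc N)) (sumTo-suc N f)) (ℚP.+-assoc (f 0) _ _)

sumTo-+-split : ∀ a d (f : ℕ → ℚ) → sumTo (a ℕ.+ d) f ≡ sumTo a f + sumTo d (λ l → f (a ℕ.+ l))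
sumTo-+-split a zero    f rewrite ℕP.+-identityʳ a = sym (ℚP.+-identityʳ (sumTo a f))
sumTo-+-split a (suc d) f rewrite ℕP.+-suc a d =
  trans (cong (_+ f (a ℕ.+ d)) (sumTo-+-split a d f)) (ℚP.+-assoc (sumTo a f) _ _)

sumTo-vanishing-tail : ∀ a N (f : ℕ → ℚ) → a ℕ.≤ N → (∀ k → a ℕ.≤ k → f k ≡ 0ℚ) →
  sumTo N f ≡ sumTo a f
sumTo-vanishing-tail a N f a≤N tail≡0 = begin
  sumTo N f                                      ≡⟨ cong (λ w → sumTo w f) (sym (ℕP.m+[n∸m]≡n a≤N)) ⟩
  sumTo (a ℕ.+ (N ∸ a)) f                        ≡⟨ sumTo-+-split a (N ∸ a) f ⟩
  sumTo a f + sumTo (N ∸ a) (λ l → f (a ℕ.+ l))  ≡⟨ cong (sumTo a f +_) tail-sum ⟩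
  sumTo a f + 0ℚ                                 ≡⟨ ℚP.+-identityʳ _ ⟩
  sumTo a f                                      ∎
  where
  tail-sum : sumTo (N ∸ a) (λ l → f (a ℕ.+ l)) ≡ 0ℚ
  tail-sum = trans (sumTo-cong (N ∸ a) (λ l → tail≡0 (a ℕ.+ l) (ℕP.m≤m+n a l))) (sumTo-zero (N ∸ a))

sumTo-swap : ∀ A B (f : ℕ → ℕ → ℚ) →
  sumTo A (λ a → sumTo B (f a)) ≡ sumTo B (λ b → sumTo A (λ a → f a b))
sumTo-swap zero    B f = sym (sumTo-zero B)
sumTo-swap (suc A) B f = trans (cong (_+ sumTo B (f A)) (sumTo-swap A B f))
  (sym (sumTo-+ B (λ b → sumTo A (λ a → f a b)) (f A)))

sumTo-telescope : ∀ N (F : ℕ → ℚ) → sumTo N (λ j → F j - F (suc j)) ≡ F 0 - F N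
sumTo-telescope zero    F = sym (ℚP.+-inverseʳ (F 0))
sumTo-telescope (suc N) F = trans (cong (_+ (F N - F (suc N))) (sumTo-telescope N F))
  (solve 3 (λ a b c → (a :- b) :+ (b :- c) := a :- c) refl (F 0) (F N) (F (suc N)))

sumList-++ : ∀ (xs ys : List ℚ) → sumList (xs ++ ys) ≡ sumList xs + sumList ys
sumList-++ []       ys = sym (ℚP.+-identityˡ _)
sumList-++ (x ∷ xs) ys = trans (cong (x +_) (sumList-++ xs ys)) (sym (ℚP.+-assoc x _ _))

sumList-map-cong : ∀ {B : Set} {f g : B → ℚ} (xs : List B) → (∀ x → f x ≡ g x) →
  sumList (map f xs) ≡ sumList (map g xs)
sumList-map-cong xs f≗g = cong sumList (ListP.map-cong f≗g xs)

sumList-map-∘ : ∀ {B C : Set} (h : C → ℚ) (g : B → C) (xs : List B) →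
  sumList (map h (map g xs)) ≡ sumList (map (h ∘ g) xs)
sumList-map-∘ h g xs = cong sumList (sym (ListP.map-∘ xs))

sumList-concatMap : ∀ {B C : Set} (h : C → ℚ) (k : B → List C) (xs : List B) →
  sumList (map h (concatMap k xs)) ≡ sumList (map (λ x → sumList (map h (k x))) xs)
sumList-concatMap h k []       = refl
sumList-concatMap h k (x ∷ xs) = trans (cong sumList (ListP.map-++ h (k x) (concatMap k xs)))
  (trans (sumList-++ (map h (k x)) _) (cong (sumList (map h (k x)) +_) (sumList-concatMap h k xs)))

sumList-applyUpTo : ∀ {B : Set} n (g : B → ℚ) (f : ℕ → B) →
  sumList (map g (applyUpTo f n)) ≡ sumTo n (g ∘ f)
sumList-applyUpTo zero    g f = refl
sumList-applyUpTo (suc n) g f =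
  trans (cong (g (f 0) +_) (sumList-applyUpTo n g (f ∘ suc))) (sym (sumTo-suc n (g ∘ f)))

sumList-upTo : ∀ n (g : ℕ → ℚ) → sumList (map g (upTo n)) ≡ sumTo n g
sumList-upTo n g = sumList-applyUpTo n g (λ x → x)

sumList-*ˡ : ∀ {B : Set} c (f : B → ℚ) (xs : List B) →
  c * sumList (map f xs) ≡ sumList (map (λ x → c * f x) xs)
sumList-*ˡ c f []       = ℚP.*-zeroʳ c
sumList-*ˡ c f (x ∷ xs) = trans (ℚP.*-distribˡ-+ c (f x) _) (cong (c * f x +_) (sumList-*ˡ c f xs))

sumList-sumTo : ∀ {B : Set} N (f : B → ℕ → ℚ) (xs : List B) →
  sumList (map (λ x → sumTo N (f x)) xs) ≡ sumTo N (λ j → sumList (map (λ x → f x j) xs))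
sumList-sumTo N f []       = sym (sumTo-zero N)
sumList-sumTo N f (x ∷ xs) = trans (cong (sumTo N (f x) +_) (sumList-sumTo N f xs))
  (sym (sumTo-+ N (f x) (λ j → sumList (map (λ x → f x j) xs))))

-- Sums over weak compositions

-- compSum j k p = G_j(k, p)
compSum : ℕ → ℕ → ℕ → ℚ
compSum j zero    zero    = 1ℚ
compSum j zero    (suc p) = 0ℚ
compSum j (suc k) p       = sumTo (suc p) (λ a → (recip j ^ℚ suc a) * compSum (suc j) k (p ∸ a))

compSum⁻ : ℕ → ℕ → ℕ → ℚ
compSum⁻ j k zero    = 0ℚ
compSum⁻ j k (suc p) = compSum j k p

compSum-zero-parts : ∀ j j′ p → compSum j 0 p ≡ compSum j′ 0 p
compSum-zero-parts j j′ zero    = refl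
compSum-zero-parts j j′ (suc p) = refl

-- Split according to whether α₁ = 0.
compSum-first : ∀ j k p →
  compSum j (suc k) p ≡ recip j * (compSum (suc j) k p + compSum⁻ j (suc k) p)
compSum-first j k zero = solve 2 (λ u g → con 0ℚ :+ (u :* con 1ℚ) :* g := u :* (g :+ con 0ℚ)) refl
  (recip j) (compSum (suc j) k 0)
compSum-first j k (suc p) = begin
  compSum j (suc k) (suc p)
    ≡⟨ sumTo-suc (suc p) _ ⟩
  (u * 1ℚ) * compSum (suc j) k (suc p) + sumTo (suc p) (λ a → (u * (u ^ℚ suc a)) * compSum (suc j) k (p ∸ a))
    ≡⟨ cong ((u * 1ℚ) * compSum (suc j) k (suc p) +_) tail ⟩
  (u * 1ℚ) * compSum (suc j) k (suc p) + u * compSum j (suc k) p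
    ≡⟨ solve 3 (λ u a b → (u :* con 1ℚ) :* a :+ u :* b := u :* (a :+ b)) refl
         u (compSum (suc j) k (suc p)) (compSum j (suc k) p) ⟩
  u * (compSum (suc j) k (suc p) + compSum j (suc k) p) ∎
  where
  u = recip j
  tail : sumTo (suc p) (λ a → (u * (u ^ℚ suc a)) * compSum (suc j) k (p ∸ a)) ≡ u * compSum j (suc k) p
  tail = trans (sumTo-cong (suc p) (λ a → ℚP.*-assoc u _ _)) (sym (sumTo-*ˡ (suc p) u _))

-- Split according to whether α_k = 0.
compSum-last : ∀ j k p →
  compSum j (suc k) p ≡ recip (j ℕ.+ k) * (compSum j k p + compSum⁻ j (suc k) p)
compSum-last j zero p rewrite ℕP.+-identityʳ j =
  trans (compSum-first j 0 p) (cong (λ g → recip j * (g + compSum⁻ j 1 p)) (compSum-zero-parts (suc j) j p))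
compSum-last j (suc k) zero rewrite ℕP.+-suc j k = begin
  compSum j (suc (suc k)) 0
    ≡⟨ compSum-first j (suc k) 0 ⟩
  u * (compSum (suc j) (suc k) 0 + 0ℚ)
    ≡⟨ cong (λ g → u * (g + 0ℚ)) (compSum-last (suc j) k 0) ⟩
  u * (z * (compSum (suc j) k 0 + 0ℚ) + 0ℚ)
    ≡⟨ solve 3 (λ u z a → u :* (z :* (a :+ con 0ℚ) :+ con 0ℚ) := z :* (u :* (a :+ con 0ℚ) :+ con 0ℚ)) refl
         u z (compSum (suc j) k 0) ⟩
  z * (u * (compSum (suc j) k 0 + 0ℚ) + 0ℚ)
    ≡⟨ cong (λ g → z * (g + 0ℚ)) (sym (compSum-first j k 0)) ⟩
  z * (compSum j (suc k) 0 + 0ℚ) ∎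
  where
  u = recip j
  z = recip (suc (j ℕ.+ k))
compSum-last j (suc k) (suc p) = begin
  compSum j (suc (suc k)) (suc p)
    ≡⟨ compSum-first j (suc k) (suc p) ⟩
  u * (compSum (suc j) (suc k) (suc p) + compSum j (suc (suc k)) p)
    ≡⟨ cong₂ (λ g h → u * (g + h)) (compSum-last (suc j) k (suc p)) (compSum-last j (suc k) p) ⟩
  u * (z * (A + B) + recip (j ℕ.+ suc k) * (C + D))
    ≡⟨ cong (λ w → u * (z * (A + B) + recip w * (C + D))) (ℕP.+-suc j k) ⟩
  u * (z * (A + B) + z * (C + D))
    ≡⟨ solve 6 (λ u z a b c d → u :* (z :* (a :+ b) :+ z :* (c :+ d)) := z :* (u :* (a :+ c) :+ u :* (b :+ d)))
         refl u z A B C D ⟩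
  z * (u * (A + C) + u * (B + D))
    ≡⟨ cong₂ (λ g h → z * (g + h)) (sym (compSum-first j k (suc p))) (sym (compSum-first j (suc k) p)) ⟩
  z * (compSum j (suc k) (suc p) + compSum j (suc (suc k)) p)
    ≡⟨ cong (λ w → recip w * (compSum j (suc k) (suc p) + compSum j (suc (suc k)) p)) (sym (ℕP.+-suc j k)) ⟩
  recip (j ℕ.+ suc k) * (compSum j (suc k) (suc p) + compSum j (suc (suc k)) p) ∎
  where
  u = recip j
  z = recip (suc (j ℕ.+ k))
  A = compSum (suc j) k (suc p)
  B = compSum (suc j) (suc k) p
  C = compSum j (suc k) p
  D = compSum⁻ j (suc (suc k)) p

-- (k+1)/((j+1)(j+k+2)) = 1/(j+1) − 1/(j+k+2), with the subtraction moved to the other side.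
recip-partialFraction : ∀ j k → (fromℕ (suc k) * recip j + 1ℚ) * recip (suc j ℕ.+ k) ≡ recip j
recip-partialFraction j k = begin
  (K * u + 1ℚ) * z             ≡⟨ cong (λ w → (K * u + w) * z) (sym (recip-*-fromℕ j)) ⟩
  (K * u + u * s) * z          ≡⟨ solve 4 (λ K u s z → (K :* u :+ u :* s) :* z := u :* (z :* (s :+ K))) refl K u s z ⟩
  u * (z * (s + K))            ≡⟨ cong (λ w → u * (z * w)) (sym (fromℕ-+ (suc j) (suc k))) ⟩
  u * (z * fromℕ (suc j ℕ.+ suc k))      ≡⟨ cong (λ w → u * (z * fromℕ (suc w))) (ℕP.+-suc j k) ⟩
  u * (z * fromℕ (suc (suc j ℕ.+ k)))    ≡⟨ cong (u *_) (recip-*-fromℕ (suc j ℕ.+ k)) ⟩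
  u * 1ℚ                       ≡⟨ ℚP.*-identityʳ u ⟩
  u                            ∎
  where
  K = fromℕ (suc k)
  u = recip j
  z = recip (suc j ℕ.+ k)
  s = fromℕ (suc j)

compSum-partialFraction : ∀ j k p →
  fromℕ (suc k) * compSum j (suc (suc k)) p ≡ compSum j (suc k) p - compSum (suc j) (suc k) p
compSum-partialFraction j k p = begin
  K * compSum j (suc (suc k)) p
    ≡⟨ cong (K *_) (compSum-first j (suc k) p) ⟩
  K * (u * (compSum (suc j) (suc k) p + d))
    ≡⟨ cong (λ w → K * (u * (w + d))) (compSum-last (suc j) k p) ⟩
  K * (u * (z * (a + c) + d))
    ≡⟨ solve 6 (λ K u z a c d → K :* (u :* (z :* (a :+ c) :+ d))
                   := ((K :* u :+ con 1ℚ) :* z) :* (a :+ c) :- z :* (a :+ c) :+ u :* (K :* d)) refl K u z a c d ⟩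
  ((K * u + 1ℚ) * z) * (a + c) - z * (a + c) + u * (K * d)
    ≡⟨ cong₂ (λ g h → g * (a + c) - z * (a + c) + u * h) (recip-partialFraction j k) (shifted p) ⟩
  u * (a + c) - z * (a + c) + u * (b - c)
    ≡⟨ solve 5 (λ u z a b c → u :* (a :+ c) :- z :* (a :+ c) :+ u :* (b :- c) := u :* (a :+ b) :- z :* (a :+ c))
         refl u z a b c ⟩
  u * (a + b) - z * (a + c)
    ≡⟨ cong₂ _-_ (sym (compSum-first j k p)) (sym (compSum-last (suc j) k p)) ⟩
  compSum j (suc k) p - compSum (suc j) (suc k) p ∎
  where
  K = fromℕ (suc k)
  u = recip j
  z = recip (suc j ℕ.+ k)
  a = compSum (suc j) k p
  b = compSum⁻ j (suc k) p
  c = compSum⁻ (suc j) (suc k) p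
  d = compSum⁻ j (suc (suc k)) p
  shifted : ∀ p → K * compSum⁻ j (suc (suc k)) p ≡ compSum⁻ j (suc k) p - compSum⁻ (suc j) (suc k) p
  shifted zero    = ℚP.*-zeroʳ K
  shifted (suc p) = compSum-partialFraction j k p

-- The η-summands summed over compositions

sumList-comps-suc : ∀ k q (f : List ℕ → ℚ) →
  sumList (map f (comps (suc k) q)) ≡ sumTo (suc q) (λ a → sumList (map (f ∘ (a ∷_)) (comps k (q ∸ a))))
sumList-comps-suc k q f = begin
  sumList (map f (comps (suc k) q))
    ≡⟨ sumList-concatMap f (λ a → map (a ∷_) (comps k (q ∸ a))) (upTo (suc q)) ⟩
  sumList (map (λ a → sumList (map f (map (a ∷_) (comps k (q ∸ a))))) (upTo (suc q)))
    ≡⟨ sumList-upTo (suc q) _ ⟩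
  sumTo (suc q) (λ a → sumList (map f (map (a ∷_) (comps k (q ∸ a)))))
    ≡⟨ sumTo-cong (suc q) (λ a → sumList-map-∘ f (a ∷_) (comps k (q ∸ a))) ⟩
  sumTo (suc q) (λ a → sumList (map (f ∘ (a ∷_)) (comps k (q ∸ a)))) ∎

sumList-comps-cong : ∀ k q {f g : List ℕ → ℚ} → (∀ b β → f (b ∷ β) ≡ g (b ∷ β)) →
  sumList (map f (comps (suc k) q)) ≡ sumList (map g (comps (suc k) q))
sumList-comps-cong k q {f} {g} f≗g = trans (sumList-comps-suc k q f) (trans
  (sumTo-cong (suc q) (λ a → sumList-map-cong (comps k (q ∸ a)) (f≗g a)))
  (sym (sumList-comps-suc k q g)))

onesTerm : ℕ → ℕ → ℚ
onesTerm j s = etaTermFrom j (replicate s 1)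

onesTerm-suc : ∀ j s → onesTerm j (suc s) ≡ onesTerm j s * recip (j ℕ.+ s)
onesTerm-suc j zero rewrite ℕP.+-identityʳ j =
  solve 1 (λ u → (u :* con 1ℚ) :* con 1ℚ := con 1ℚ :* u) refl (recip j)
onesTerm-suc j (suc s) = begin
  (recip j * 1ℚ) * onesTerm (suc j) (suc s)
    ≡⟨ cong ((recip j * 1ℚ) *_) (onesTerm-suc (suc j) s) ⟩
  (recip j * 1ℚ) * (onesTerm (suc j) s * recip (suc j ℕ.+ s))
    ≡⟨ cong (λ w → (recip j * 1ℚ) * (onesTerm (suc j) s * recip w)) (sym (ℕP.+-suc j s)) ⟩
  (recip j * 1ℚ) * (onesTerm (suc j) s * recip (j ℕ.+ suc s))
    ≡⟨ sym (ℚP.*-assoc (recip j * 1ℚ) (onesTerm (suc j) s) (recip (j ℕ.+ suc s))) ⟩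
  ((recip j * 1ℚ) * onesTerm (suc j) s) * recip (j ℕ.+ suc s) ∎

-- The last composed argument αₖ₊₁+2 has one more than its exponent in compSum; that extra
-- factor recip (j+k) and the block {1}^s together form onesTerm (j+k) (s+1).
sumList-comps-etaTerm : ∀ j k q s →
  sumList (map (λ α → etaTermFrom j (etaArgs α s)) (comps (suc k) q))
    ≡ compSum j (suc k) q * onesTerm (j ℕ.+ k) (suc s)
sumList-comps-etaTerm j k q s = begin
  sumList (map η (comps (suc k) q))
    ≡⟨ sumList-comps-suc k q η ⟩
  sumTo (suc q) (λ a → sumList (map (η ∘ (a ∷_)) (comps k (q ∸ a))))
    ≡⟨ sumTo-cong (suc q) (first-part k) ⟩
  sumTo (suc q) (λ a → (recip j ^ℚ suc a) * compSum (suc j) k (q ∸ a) * W k)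
    ≡⟨ sym (sumTo-*ʳ (suc q) (W k) (λ a → (recip j ^ℚ suc a) * compSum (suc j) k (q ∸ a))) ⟩
  compSum j (suc k) q * W k ∎
  where
  η : List ℕ → ℚ
  η α = etaTermFrom j (etaArgs α s)
  W : ℕ → ℚ
  W k = onesTerm (j ℕ.+ k) (suc s)
  first-part : ∀ k a →
    sumList (map (η ∘ (a ∷_)) (comps k (q ∸ a))) ≡ (recip j ^ℚ suc a) * compSum (suc j) k (q ∸ a) * W k
  first-part zero a with q ∸ a
  ... | zero rewrite ℕP.+-identityʳ j =
    solve 3 (λ u v r → (u :* v) :* r :+ con 0ℚ := (v :* con 1ℚ) :* ((u :* con 1ℚ) :* r)) refl
      (recip j) (recip j ^ℚ suc a) (onesTerm (suc j) s)
  ... | suc _ = sym (trans (cong (_* W 0) (ℚP.*-zeroʳ (recip j ^ℚ suc a))) (ℚP.*-zeroˡ (W 0)))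
  first-part (suc k) a = begin
    sumList (map (η ∘ (a ∷_)) (comps (suc k) (q ∸ a)))
      ≡⟨ sumList-comps-cong k (q ∸ a) (λ b β → refl) ⟩
    sumList (map (λ α → c * etaTermFrom (suc j) (etaArgs α s)) (comps (suc k) (q ∸ a)))
      ≡⟨ sym (sumList-*ˡ c (λ α → etaTermFrom (suc j) (etaArgs α s)) (comps (suc k) (q ∸ a))) ⟩
    c * sumList (map (λ α → etaTermFrom (suc j) (etaArgs α s)) (comps (suc k) (q ∸ a)))
      ≡⟨ cong (c *_) (sumList-comps-etaTerm (suc j) k (q ∸ a) s) ⟩
    c * (compSum (suc j) (suc k) (q ∸ a) * onesTerm (suc j ℕ.+ k) (suc s))
      ≡⟨ cong (λ w → c * (compSum (suc j) (suc k) (q ∸ a) * onesTerm w (suc s))) (sym (ℕP.+-suc j k)) ⟩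
    c * (compSum (suc j) (suc k) (q ∸ a) * W (suc k))
      ≡⟨ sym (ℚP.*-assoc c (compSum (suc j) (suc k) (q ∸ a)) (W (suc k))) ⟩
    c * compSum (suc j) (suc k) (q ∸ a) * W (suc k) ∎
    where
    c = recip j ^ℚ suc a

-- Classify the compositions of q+1 into n+1 parts by the position r of their last nonzero part.
compSum-byLastNonzero : ∀ j n q →
  sumTo (suc n) (λ r → compSum j (suc r) q * onesTerm (j ℕ.+ r) (suc (n ∸ r))) ≡ compSum j (suc n) (suc q)
compSum-byLastNonzero j zero q = begin
  0ℚ + compSum j 1 q * ((u * 1ℚ) * 1ℚ)  ≡⟨ solve 2 (λ u g → con 0ℚ :+ g :* ((u :* con 1ℚ) :* con 1ℚ) := u :* (con 0ℚ :+ g))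
                                             refl u (compSum j 1 q) ⟩
  u * (0ℚ + compSum j 1 q)               ≡⟨ sym (compSum-last j 0 (suc q)) ⟩
  compSum j 1 (suc q)                    ∎
  where u = recip (j ℕ.+ 0)
compSum-byLastNonzero j (suc n) q = begin
  sumTo (suc n) (term (suc n)) + A * onesTerm (j ℕ.+ suc n) (suc (n ∸ n))
    ≡⟨ cong₂ _+_ (sumTo-cong-< (suc n) one-more-one) (cong (λ v → A * onesTerm v (suc (n ∸ n))) (ℕP.+-suc j n)) ⟩
  sumTo (suc n) (λ r → term n r * w) + A * onesTerm (suc (j ℕ.+ n)) (suc (n ∸ n))
    ≡⟨ cong₂ _+_ (sym (sumTo-*ʳ (suc n) w (term n))) (cong (λ v → A * onesTerm (suc (j ℕ.+ n)) (suc v)) (ℕP.n∸n≡0 n)) ⟩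
  sumTo (suc n) (term n) * w + A * ((w * 1ℚ) * 1ℚ)
    ≡⟨ cong (λ v → v * w + A * ((w * 1ℚ) * 1ℚ)) (compSum-byLastNonzero j n q) ⟩
  compSum j (suc n) (suc q) * w + A * ((w * 1ℚ) * 1ℚ)
    ≡⟨ solve 3 (λ a b w → a :* w :+ b :* ((w :* con 1ℚ) :* con 1ℚ) := w :* (a :+ b)) refl (compSum j (suc n) (suc q)) A w ⟩
  w * (compSum j (suc n) (suc q) + A)
    ≡⟨ cong (λ v → recip v * (compSum j (suc n) (suc q) + A)) (sym (ℕP.+-suc j n)) ⟩
  recip (j ℕ.+ suc n) * (compSum j (suc n) (suc q) + A)
    ≡⟨ sym (compSum-last j (suc n) (suc q)) ⟩
  compSum j (suc (suc n)) (suc q) ∎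
  where
  A = compSum j (suc (suc n)) q
  w = recip (suc (j ℕ.+ n))
  term : ℕ → ℕ → ℚ
  term n r = compSum j (suc r) q * onesTerm (j ℕ.+ r) (suc (n ∸ r))
  one-more-one : ∀ r → r ℕ.< suc n → term (suc n) r ≡ term n r * w
  one-more-one r r<sn = begin
    compSum j (suc r) q * onesTerm (j ℕ.+ r) (suc (suc n ∸ r))
      ≡⟨ cong (λ v → compSum j (suc r) q * onesTerm (j ℕ.+ r) (suc v)) (ℕP.+-∸-assoc 1 r≤n) ⟩
    compSum j (suc r) q * onesTerm (j ℕ.+ r) (suc (suc (n ∸ r)))
      ≡⟨ cong (compSum j (suc r) q *_) (onesTerm-suc (j ℕ.+ r) (suc (n ∸ r))) ⟩
    compSum j (suc r) q * (onesTerm (j ℕ.+ r) (suc (n ∸ r)) * recip (j ℕ.+ r ℕ.+ suc (n ∸ r)))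
      ≡⟨ cong (λ v → compSum j (suc r) q * (onesTerm (j ℕ.+ r) (suc (n ∸ r)) * recip v)) last-index ⟩
    compSum j (suc r) q * (onesTerm (j ℕ.+ r) (suc (n ∸ r)) * w)
      ≡⟨ sym (ℚP.*-assoc (compSum j (suc r) q) _ w) ⟩
    term n r * w ∎
    where
    r≤n = ℕP.≤-pred r<sn
    last-index : j ℕ.+ r ℕ.+ suc (n ∸ r) ≡ suc (j ℕ.+ n)
    last-index = trans (ℕP.+-suc (j ℕ.+ r) (n ∸ r))
                       (cong suc (trans (ℕP.+-assoc j r (n ∸ r)) (cong (j ℕ.+_) (ℕP.m+[n∸m]≡n r≤n))))

lhsPartial≡sumTo-compSum : ∀ n q N → lhsPartial n q N ≡ sumTo N (λ j → compSum j (suc n) (suc q))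
lhsPartial≡sumTo-compSum n q N = begin
  lhsPartial n q N
    ≡⟨ sumTo-cong (suc n) (λ r → sumList-sumTo N (λ α j → η j r α) (comps (suc r) q)) ⟩
  sumTo (suc n) (λ r → sumTo N (λ j → sumList (map (η j r) (comps (suc r) q))))
    ≡⟨ sumTo-swap (suc n) N (λ r j → sumList (map (η j r) (comps (suc r) q))) ⟩
  sumTo N (λ j → sumTo (suc n) (λ r → sumList (map (η j r) (comps (suc r) q))))
    ≡⟨ sumTo-cong N (λ j → trans (sumTo-cong (suc n) (λ r → sumList-comps-etaTerm j r q (n ∸ r)))
                                 (compSum-byLastNonzero j n q)) ⟩
  sumTo N (λ j → compSum j (suc n) (suc q)) ∎
  where
  η : ℕ → ℕ → List ℕ → ℚ
  η j r α = etaTermFrom j (etaArgs α (n ∸ r))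

lhsPartial-telescopes : ∀ m q N →
  lhsPartial (suc m) q N ≡ recip m * compSum 0 (suc m) (suc q) - recip m * compSum N (suc m) (suc q)
lhsPartial-telescopes m q N = begin
  lhsPartial (suc m) q N                          ≡⟨ lhsPartial≡sumTo-compSum (suc m) q N ⟩
  sumTo N (λ j → compSum j (suc (suc m)) (suc q))  ≡⟨ sumTo-cong N difference ⟩
  sumTo N (λ j → F j - F (suc j))                  ≡⟨ sumTo-telescope N F ⟩
  F 0 - F N                                        ∎
  where
  F : ℕ → ℚ
  F j = recip m * compSum j (suc m) (suc q)
  difference : ∀ j → compSum j (suc (suc m)) (suc q) ≡ F j - F (suc j)
  difference j = begin
    compSum j (suc (suc m)) (suc q)
      ≡⟨ sym (recip-cancel m _) ⟩
    recip m * (fromℕ (suc m) * compSum j (suc (suc m)) (suc q))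
      ≡⟨ cong (recip m *_) (compSum-partialFraction j m (suc q)) ⟩
    recip m * (compSum j (suc m) (suc q) - compSum (suc j) (suc m) (suc q))
      ≡⟨ solve 3 (λ u a b → u :* (a :- b) := u :* a :- u :* b) refl
           (recip m) (compSum j (suc m) (suc q)) (compSum (suc j) (suc m) (suc q)) ⟩
    F j - F (suc j) ∎

-- Complete homogeneous polynomials and Newton's identities

-- hom j k p is the complete homogeneous symmetric polynomial h_p(recip j, …, recip (j+k-1)).
hom : ℕ → ℕ → ℕ → ℚ
hom j zero    zero    = 1ℚ
hom j zero    (suc p) = 0ℚ
hom j (suc k) zero    = hom (suc j) k zero
hom j (suc k) (suc p) = hom (suc j) k (suc p) + recip j * hom j (suc k) p

hom⁻ : ℕ → ℕ → ℕ → ℚ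
hom⁻ j k zero    = 0ℚ
hom⁻ j k (suc p) = hom j k p

hom-first : ∀ j k p → hom j (suc k) p ≡ hom (suc j) k p + recip j * hom⁻ j (suc k) p
hom-first j k zero    = sym (trans (cong (hom (suc j) k 0 +_) (ℚP.*-zeroʳ (recip j))) (ℚP.+-identityʳ _))
hom-first j k (suc p) = refl

hom-zero-degree : ∀ j k → hom j k 0 ≡ 1ℚ
hom-zero-degree j zero    = refl
hom-zero-degree j (suc k) = hom-zero-degree (suc j) k

recipProd : ℕ → ℕ → ℚ
recipProd j zero    = 1ℚ
recipProd j (suc k) = recip j * recipProd (suc j) k

recipProd-last : ∀ j k → recipProd j (suc k) ≡ recipProd j k * recip (j ℕ.+ k)
recipProd-last j zero rewrite ℕP.+-identityʳ j = trans (ℚP.*-identityʳ (recip j)) (sym (ℚP.*-identityˡ (recip j)))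
recipProd-last j (suc k) = begin
  recip j * recipProd (suc j) (suc k)                 ≡⟨ cong (recip j *_) (recipProd-last (suc j) k) ⟩
  recip j * (recipProd (suc j) k * recip (suc j ℕ.+ k)) ≡⟨ sym (ℚP.*-assoc (recip j) (recipProd (suc j) k) _) ⟩
  recipProd j (suc k) * recip (suc j ℕ.+ k)           ≡⟨ cong (λ w → recipProd j (suc k) * recip w) (sym (ℕP.+-suc j k)) ⟩
  recipProd j (suc k) * recip (j ℕ.+ suc k)           ∎

recipProd-zero≡invFact : ∀ n → recipProd 0 n ≡ invFact n
recipProd-zero≡invFact zero    = refl
recipProd-zero≡invFact (suc n) = trans (recipProd-last 0 n)
  (trans (cong (_* recip n) (recipProd-zero≡invFact n)) (ℚP.*-comm (invFact n) (recip n)))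

-- Shifting every exponent αᵢ+1 down by one pulls out the factor recipProd.
compSum≡recipProd*hom : ∀ j k p → compSum j k p ≡ recipProd j k * hom j k p
compSum≡recipProd*hom j zero zero    = refl
compSum≡recipProd*hom j zero (suc p) = sym (ℚP.*-zeroʳ 1ℚ)
compSum≡recipProd*hom j (suc k) p = begin
  compSum j (suc k) p
    ≡⟨ compSum-first j k p ⟩
  u * (compSum (suc j) k p + compSum⁻ j (suc k) p)
    ≡⟨ cong₂ (λ a b → u * (a + b)) (compSum≡recipProd*hom (suc j) k p) (shifted p) ⟩
  u * (e * hom (suc j) k p + u * e * hom⁻ j (suc k) p)
    ≡⟨ solve 4 (λ u e a b → u :* (e :* a :+ u :* e :* b) := (u :* e) :* (a :+ u :* b)) refl
         u e (hom (suc j) k p) (hom⁻ j (suc k) p) ⟩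
  (u * e) * (hom (suc j) k p + u * hom⁻ j (suc k) p)
    ≡⟨ cong ((u * e) *_) (sym (hom-first j k p)) ⟩
  recipProd j (suc k) * hom j (suc k) p ∎
  where
  u = recip j
  e = recipProd (suc j) k
  shifted : ∀ p → compSum⁻ j (suc k) p ≡ u * e * hom⁻ j (suc k) p
  shifted zero    = sym (ℚP.*-zeroʳ (u * e))
  shifted (suc p) = compSum≡recipProd*hom j (suc k) p

powerSum : ℕ → ℕ → ℕ → ℚ
powerSum j k i = sumTo k (λ l → recip (j ℕ.+ l) ^ℚ i)

powerSum-first : ∀ j k i → powerSum j (suc k) i ≡ recip j ^ℚ i + powerSum (suc j) k i
powerSum-first j k i = trans (sumTo-suc k (λ l → recip (j ℕ.+ l) ^ℚ i))
  (cong₂ _+_ (cong (λ w → recip w ^ℚ i) (ℕP.+-identityʳ j))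
             (sumTo-cong k (λ l → cong (λ w → recip w ^ℚ i) (ℕP.+-suc j l))))

newtonSum : ℕ → ℕ → ℕ → ℚ
newtonSum j k p = sumTo p (λ i → powerSum j k (suc i) * hom j k (p ∸ suc i))

newtonSum-first : ∀ j k p →
  newtonSum j (suc k) (suc p) ≡ newtonSum (suc j) k (suc p) + recip j * (newtonSum j (suc k) p + hom j (suc k) p)
newtonSum-first j k p = begin
  newtonSum j (suc k) (suc p)
    ≡⟨ sumTo-cong (suc p) split-summand ⟩
  sumTo (suc p) (λ i → A i + (u * B i + C i))
    ≡⟨ trans (sumTo-+ (suc p) A _) (cong (N′ +_) (sumTo-+ (suc p) _ C)) ⟩
  N′ + (sumTo (suc p) (λ i → u * B i) + sumTo (suc p) C)
    ≡⟨ cong (λ z → N′ + (z + sumTo (suc p) C)) (sym (sumTo-*ˡ (suc p) u B)) ⟩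
  N′ + (u * sumTo (suc p) B + sumTo (suc p) C)
    ≡⟨ cong₂ (λ b c → N′ + (u * b + c)) shifted-powers leading-power ⟩
  N′ + (u * X + (u * h p + u * Y))
    ≡⟨ cong (N′ +_) (solve 4 (λ u X h Y → u :* X :+ (u :* h :+ u :* Y) := u :* ((Y :+ X) :+ h)) refl u X (h p) Y) ⟩
  N′ + u * ((Y + X) + h p)
    ≡⟨ cong (λ w → N′ + u * (w + h p)) recombine ⟩
  N′ + u * (newtonSum j (suc k) p + h p) ∎
  where
  u  = recip j
  h  = hom j (suc k)
  h⁻ = hom⁻ j (suc k)
  h′ = hom (suc j) k
  ps = powerSum (suc j) k
  N′ = newtonSum (suc j) k (suc p)
  A B C : ℕ → ℚ
  A i = ps (suc i) * h′ (p ∸ i)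
  B i = ps (suc i) * h⁻ (p ∸ i)
  C i = (u ^ℚ suc i) * h (p ∸ i)
  X = sumTo p (λ i → ps (suc i) * h (p ∸ suc i))
  Y = sumTo p (λ i → (u ^ℚ suc i) * h (p ∸ suc i))
  split-summand : ∀ i → powerSum j (suc k) (suc i) * h (p ∸ i) ≡ A i + (u * B i + C i)
  split-summand i = begin
    powerSum j (suc k) (suc i) * h (p ∸ i)
      ≡⟨ cong₂ _*_ (powerSum-first j k (suc i)) (hom-first j k (p ∸ i)) ⟩
    ((u ^ℚ suc i) + ps (suc i)) * (h′ (p ∸ i) + u * h⁻ (p ∸ i))
      ≡⟨ solve 5 (λ U P a u b → (U :+ P) :* (a :+ u :* b) := P :* a :+ (u :* (P :* b) :+ U :* (a :+ u :* b)))
           refl (u ^ℚ suc i) (ps (suc i)) (h′ (p ∸ i)) u (h⁻ (p ∸ i)) ⟩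
    A i + (u * B i + (u ^ℚ suc i) * (h′ (p ∸ i) + u * h⁻ (p ∸ i)))
      ≡⟨ cong (λ z → A i + (u * B i + (u ^ℚ suc i) * z)) (sym (hom-first j k (p ∸ i))) ⟩
    A i + (u * B i + C i) ∎
  shifted-powers : sumTo (suc p) B ≡ X
  shifted-powers = trans
    (cong₂ _+_ (sumTo-cong-< p (λ i i<p → cong (λ w → ps (suc i) * h⁻ w) (ℕP.+-∸-assoc 1 i<p)))
               (cong (λ w → ps (suc p) * h⁻ w) (ℕP.n∸n≡0 p)))
    (trans (cong (X +_) (ℚP.*-zeroʳ (ps (suc p)))) (ℚP.+-identityʳ X))
  leading-power : sumTo (suc p) C ≡ u * h p + u * Y
  leading-power = trans (sumTo-suc p C)
    (cong₂ _+_ (cong (_* h p) (ℚP.*-identityʳ u))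
               (trans (sumTo-cong p (λ i → ℚP.*-assoc u (u ^ℚ suc i) (h (p ∸ suc i))))
                      (sym (sumTo-*ˡ p u (λ i → (u ^ℚ suc i) * h (p ∸ suc i))))))
  recombine : Y + X ≡ newtonSum j (suc k) p
  recombine = trans (sym (sumTo-+ p _ _)) (sumTo-cong p (λ i →
    trans (sym (ℚP.*-distribʳ-+ (h (p ∸ suc i)) (u ^ℚ suc i) (ps (suc i))))
          (cong (_* h (p ∸ suc i)) (sym (powerSum-first j k (suc i))))))

hom-newton : ∀ j k p → fromℕ p * hom j k p ≡ newtonSum j k p
hom-newton j zero zero    = ℚP.*-zeroˡ 1ℚ
hom-newton j zero (suc p) = trans (ℚP.*-zeroʳ (fromℕ (suc p)))
  (sym (trans (sumTo-cong (suc p) (λ i → ℚP.*-zeroˡ (hom j 0 (p ∸ i)))) (sumTo-zero (suc p))))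
hom-newton j (suc k) zero = ℚP.*-zeroˡ (hom j (suc k) 0)
hom-newton j (suc k) (suc p) = begin
  fromℕ (suc p) * (h′ (suc p) + u * h p)
    ≡⟨ cong (λ w → w * (h′ (suc p) + u * h p)) (fromℕ-+ 1 p) ⟩
  (1ℚ + fromℕ p) * (h′ (suc p) + u * h p)
    ≡⟨ solve 4 (λ I a u b → (con 1ℚ :+ I) :* (a :+ u :* b) := (con 1ℚ :+ I) :* a :+ u :* (I :* b :+ b))
         refl (fromℕ p) (h′ (suc p)) u (h p) ⟩
  (1ℚ + fromℕ p) * h′ (suc p) + u * (fromℕ p * h p + h p)
    ≡⟨ cong₂ (λ a b → a * h′ (suc p) + u * (b + h p)) (sym (fromℕ-+ 1 p)) (hom-newton j (suc k) p) ⟩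
  fromℕ (suc p) * h′ (suc p) + u * (newtonSum j (suc k) p + h p)
    ≡⟨ cong (_+ u * (newtonSum j (suc k) p + h p)) (hom-newton (suc j) k (suc p)) ⟩
  newtonSum (suc j) k (suc p) + u * (newtonSum j (suc k) p + h p)
    ≡⟨ sym (newtonSum-first j k p) ⟩
  newtonSum j (suc k) (suc p) ∎
  where
  u  = recip j
  h  = hom j (suc k)
  h′ = hom (suc j) k

NewtonRecurrence : (t a : ℕ → ℚ) → ℕ → Set
NewtonRecurrence t a M = ∀ r → r ≤ M → fromℕ r * a r ≡ sumTo r (λ i → t (suc i) * a (r ∸ suc i))

newtonRecurrence-unique : ∀ {t a b : ℕ → ℚ} {M} → a 0 ≡ b 0 →
  NewtonRecurrence t a M → NewtonRecurrence t b M → ∀ r → r ≤ M → a r ≡ b r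
newtonRecurrence-unique {t} {a} {b} {M} a₀≡b₀ rec-a rec-b = <-rec _ step
  where
  step : ∀ r → (∀ {s} → s < r → s ≤ M → a s ≡ b s) → r ≤ M → a r ≡ b r
  step zero    _  _    = a₀≡b₀
  step (suc r) ih r<M = begin
    a (suc r)                                                      ≡⟨ sym (recip-cancel r (a (suc r))) ⟩
    recip r * (fromℕ (suc r) * a (suc r))                          ≡⟨ cong (recip r *_) (rec-a (suc r) r<M) ⟩
    recip r * sumTo (suc r) (λ i → t (suc i) * a (suc r ∸ suc i))  ≡⟨ cong (recip r *_) (sumTo-cong-< (suc r) lower) ⟩
    recip r * sumTo (suc r) (λ i → t (suc i) * b (suc r ∸ suc i))  ≡⟨ cong (recip r *_) (sym (rec-b (suc r) r<M)) ⟩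
    recip r * (fromℕ (suc r) * b (suc r))                          ≡⟨ recip-cancel r (b (suc r)) ⟩
    b (suc r)                                                      ∎
    where
    lower : ∀ i → i < suc r → t (suc i) * a (r ∸ i) ≡ t (suc i) * b (r ∸ i)
    lower i _ = cong (t (suc i) *_) (ih (s≤s (ℕP.m∸n≤m r i))
                                        (ℕP.≤-trans (ℕP.m∸n≤m r i) (ℕP.≤-trans (ℕP.n≤1+n r) r<M)))

-- The polynomials P_m

when : Bool → ℚ → ℚ
when b x = if b then x else 0ℚ

private
  ≤ᵇ≡true⇒≤ : ∀ m n → (m ≤ᵇ n) ≡ true → m ≤ n
  ≤ᵇ≡true⇒≤ m n e = ℕP.≤ᵇ⇒≤ m n (subst T (sym e) _)

  ≤ᵇ≡false⇒≰ : ∀ {m n} → (m ≤ᵇ n) ≡ false → ¬ m ≤ n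
  ≤ᵇ≡false⇒≰ e m≤n = subst T e (ℕP.≤⇒≤ᵇ m≤n)

≤ᵇ-cong : ∀ {m n m′ n′} → (m ≤ n → m′ ≤ n′) → (m′ ≤ n′ → m ≤ n) → (m ≤ᵇ n) ≡ (m′ ≤ᵇ n′)
≤ᵇ-cong {m} {n} {m′} {n′} to from with m ≤ᵇ n in e | m′ ≤ᵇ n′ in e′
... | true  | true  = refl
... | false | false = refl
... | true  | false = ⊥-elim (≤ᵇ≡false⇒≰ e′ (to (≤ᵇ≡true⇒≤ m n e)))
... | false | true  = ⊥-elim (≤ᵇ≡false⇒≰ e (from (≤ᵇ≡true⇒≤ m′ n′ e′)))

when-≤ : ∀ {m n} x → m ≤ n → when (m ≤ᵇ n) x ≡ x
when-≤ {m} {n} x m≤n with m ≤ᵇ n in e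
... | true  = refl
... | false = ⊥-elim (≤ᵇ≡false⇒≰ e m≤n)

when-≰ : ∀ {m n} x → ¬ m ≤ n → when (m ≤ᵇ n) x ≡ 0ℚ
when-≰ {m} {n} x m≰n with m ≤ᵇ n in e
... | true  = ⊥-elim (m≰n (≤ᵇ≡true⇒≤ m n e))
... | false = refl

when-cong : ∀ b {x x′} → (T b → x ≡ x′) → when b x ≡ when b x′
when-cong true  x≡x′ = x≡x′ _
when-cong false _    = refl

when-0 : ∀ b → when b 0ℚ ≡ 0ℚ
when-0 true  = refl
when-0 false = refl

*-when : ∀ b c x → c * when b x ≡ when b (c * x)
*-when true  c x = refl
*-when false c x = ℚP.*-zeroʳ c

when-+ : ∀ b x z → when b (x + z) ≡ when b x + when b z
when-+ true  x z = refl
when-+ false x z = refl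

when-sumTo : ∀ b N (f : ℕ → ℚ) → when b (sumTo N f) ≡ sumTo N (λ l → when b (f l))
when-sumTo true  N f = refl
when-sumTo false N f = sym (sumTo-zero N)

when-when : ∀ a i r x → when (a ≤ᵇ r) (when (i ≤ᵇ r ∸ a) x) ≡ when (a ℕ.+ i ≤ᵇ r) x
when-when a i r x with a ≤ᵇ r in e
... | true = cong (λ b → when b x) (≤ᵇ-cong
  (λ i≤r-a → subst (a ℕ.+ i ≤_) (ℕP.m+[n∸m]≡n (≤ᵇ≡true⇒≤ a r e)) (ℕP.+-monoʳ-≤ a i≤r-a))
  (λ a+i≤r → subst (_≤ r ∸ a) (ℕP.m+n∸m≡n a i) (ℕP.∸-monoˡ-≤ a a+i≤r)))
... | false = sym (when-≰ x (λ a+i≤r → ≤ᵇ≡false⇒≰ e (ℕP.≤-trans (ℕP.m≤m+n a i) a+i≤r)))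

-- The terms with k > r ∸ i vanish because the weight suc s is at least 1.
sumTo-when-shift : ∀ s i r R → (i ≤ r → r ∸ i < R) → (g : ℕ → ℕ → ℚ) →
  sumTo R (λ k → when (suc s ℕ.* k ℕ.+ i ≤ᵇ r) (g k (r ∸ (suc s ℕ.* k ℕ.+ i))))
    ≡ when (i ≤ᵇ r) (sumTo (suc (r ∸ i)) (λ k → when (suc s ℕ.* k ≤ᵇ r ∸ i) (g k (r ∸ i ∸ suc s ℕ.* k))))
sumTo-when-shift s i r R bound g with i ≤ᵇ r in e
... | false = trans (sumTo-cong R (λ k → when-≰ _ (λ wk+i≤r →
                       ≤ᵇ≡false⇒≰ e (ℕP.≤-trans (ℕP.m≤n+m i (suc s ℕ.* k)) wk+i≤r))))
                    (sumTo-zero R)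
... | true = begin
  sumTo R (λ k → when (w ℕ.* k ℕ.+ i ≤ᵇ r) (g k (r ∸ (w ℕ.* k ℕ.+ i))))
    ≡⟨ sumTo-cong R (λ k → cong₂ when (guard k) (cong (g k) (reindex k))) ⟩
  sumTo R f
    ≡⟨ sumTo-vanishing-tail (suc r′) R f (bound i≤r) (λ k r′<k → when-≰ _ (λ wk≤r′ →
         ℕP.<-irrefl refl (ℕP.≤-trans r′<k (ℕP.≤-trans (ℕP.m≤n*m k w) wk≤r′)))) ⟩
  sumTo (suc r′) f ∎
  where
  w = suc s
  i≤r = ≤ᵇ≡true⇒≤ i r e
  r′ = r ∸ i
  r′+i≡r : r′ ℕ.+ i ≡ r
  r′+i≡r = ℕP.m∸n+n≡m i≤r
  f = λ k → when (w ℕ.* k ≤ᵇ r′) (g k (r′ ∸ w ℕ.* k))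
  guard : ∀ k → (w ℕ.* k ℕ.+ i ≤ᵇ r) ≡ (w ℕ.* k ≤ᵇ r′)
  guard k = ≤ᵇ-cong (λ le → ℕP.+-cancelʳ-≤ i (w ℕ.* k) r′ (subst (w ℕ.* k ℕ.+ i ≤_) (sym r′+i≡r) le))
                    (λ le → subst (w ℕ.* k ℕ.+ i ≤_) r′+i≡r (ℕP.+-monoˡ-≤ i le))
  reindex : ∀ k → r ∸ (w ℕ.* k ℕ.+ i) ≡ r′ ∸ w ℕ.* k
  reindex k = trans (cong (r ∸_) (ℕP.+-comm (w ℕ.* k) i)) (sym (ℕP.∸-+-assoc r i (w ℕ.* k)))

module _ (t : ℕ → ℚ) where

  pFactor : ℕ → ℕ → ℚ
  pFactor st k = invFact k * ((t st * recip (st ∸ 1)) ^ℚ k)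

  -- The part of P built from the variables t st, …, t (st+len−1) only, in weighted degree r.
  pPartial : ℕ → ℕ → ℕ → ℚ
  pPartial st len r = sumList (map (pTerm t st) (kvecs len st r))

  pPartial-suc : ∀ st len r → pPartial st (suc len) r
    ≡ sumTo (suc r) (λ k → when (st ℕ.* k ≤ᵇ r) (pFactor st k * pPartial (suc st) len (r ∸ st ℕ.* k)))
  pPartial-suc st len r = begin
    sumList (map (pTerm t st) (kvecs (suc len) st r))
      ≡⟨ sumList-concatMap (pTerm t st) branch (upTo (suc r)) ⟩
    sumList (map (λ k → sumList (map (pTerm t st) (branch k))) (upTo (suc r)))
      ≡⟨ sumList-upTo (suc r) _ ⟩
    sumTo (suc r) (λ k → sumList (map (pTerm t st) (branch k)))
      ≡⟨ sumTo-cong (suc r) per-k ⟩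
    sumTo (suc r) (λ k → when (st ℕ.* k ≤ᵇ r) (pFactor st k * pPartial (suc st) len (r ∸ st ℕ.* k))) ∎
    where
    branch : ℕ → List (List ℕ)
    branch k = if st ℕ.* k ≤ᵇ r then map (k ∷_) (kvecs len (suc st) (r ∸ st ℕ.* k)) else []
    per-k : ∀ k → sumList (map (pTerm t st) (branch k))
                  ≡ when (st ℕ.* k ≤ᵇ r) (pFactor st k * pPartial (suc st) len (r ∸ st ℕ.* k))
    per-k k with st ℕ.* k ≤ᵇ r
    ... | false = refl
    ... | true  = trans (sumList-map-∘ (pTerm t st) (k ∷_) (kvecs len (suc st) (r ∸ st ℕ.* k)))
                        (sym (sumList-*ˡ (pFactor st k) (pTerm t (suc st)) (kvecs len (suc st) (r ∸ st ℕ.* k))))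

  pPartial-zero-degree : ∀ st len → pPartial (suc st) len 0 ≡ 1ℚ
  pPartial-zero-degree st zero      = ℚP.+-identityʳ 1ℚ
  pPartial-zero-degree st (suc len) = begin
    pPartial (suc st) (suc len) 0
      ≡⟨ pPartial-suc (suc st) len 0 ⟩
    0ℚ + when (suc st ℕ.* 0 ≤ᵇ 0) (pFactor (suc st) 0 * pPartial (suc (suc st)) len (0 ∸ suc st ℕ.* 0))
      ≡⟨ cong (λ m → 0ℚ + when (m ≤ᵇ 0) (pFactor (suc st) 0 * pPartial (suc (suc st)) len (0 ∸ m))) (ℕP.*-zeroʳ (suc st)) ⟩
    0ℚ + (pFactor (suc st) 0 * pPartial (suc (suc st)) len 0)
      ≡⟨ cong (λ z → 0ℚ + (pFactor (suc st) 0 * z)) (pPartial-zero-degree (suc st) len) ⟩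
    1ℚ ∎

  fromℕ-*-pFactor : ∀ s k → fromℕ (suc s ℕ.* suc k) * pFactor (suc s) (suc k) ≡ t (suc s) * pFactor (suc s) k
  fromℕ-*-pFactor s k = begin
    fromℕ (suc s ℕ.* suc k) * pFactor (suc s) (suc k)
      ≡⟨ cong (_* pFactor (suc s) (suc k)) (fromℕ-* (suc s) (suc k)) ⟩
    (fromℕ (suc s) * fromℕ (suc k)) * ((recip k * invFact k) * ((ts * recip s) * X))
      ≡⟨ solve 7 (λ S K rk fk ts rs X → (S :* K) :* ((rk :* fk) :* ((ts :* rs) :* X))
                                        := (rs :* S) :* (rk :* K) :* (ts :* (fk :* X)))
           refl (fromℕ (suc s)) (fromℕ (suc k)) (recip k) (invFact k) ts (recip s) X ⟩
    (recip s * fromℕ (suc s)) * (recip k * fromℕ (suc k)) * (ts * (invFact k * X))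
      ≡⟨ cong₂ (λ a b → a * b * (ts * (invFact k * X))) (recip-*-fromℕ s) (recip-*-fromℕ k) ⟩
    1ℚ * 1ℚ * (ts * (invFact k * X))
      ≡⟨ ℚP.*-identityˡ (ts * (invFact k * X)) ⟩
    ts * pFactor (suc s) k ∎
    where
    ts = t (suc s)
    X = (ts * recip s) ^ℚ k

  newtonTerm : ℕ → ℕ → ℕ → ℕ → ℚ
  newtonTerm st len r l = when (st ℕ.+ l ≤ᵇ r) (t (st ℕ.+ l) * pPartial st len (r ∸ (st ℕ.+ l)))

  -- The summands in which the first variable t st occurs: st·k·c_k = t_st·c_{k−1}.
  pPartial-newton-first : ∀ s len r →
    sumTo (suc r) (λ k → when (suc s ℕ.* k ≤ᵇ r)
                             ((fromℕ (suc s ℕ.* k) * pFactor (suc s) k) * pPartial (suc (suc s)) len (r ∸ suc s ℕ.* k)))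
      ≡ when (suc s ≤ᵇ r) (t (suc s) * pPartial (suc s) (suc len) (r ∸ suc s))
  pPartial-newton-first s len r = begin
    sumTo (suc r) fA
      ≡⟨ sumTo-suc r fA ⟩
    fA 0 + sumTo r (λ k → fA (suc k))
      ≡⟨ cong₂ _+_ fA-0 (sumTo-cong r fA-suc) ⟩
    0ℚ + sumTo r (λ k → when (st ℕ.* k ℕ.+ st ≤ᵇ r) (g k (r ∸ (st ℕ.* k ℕ.+ st))))
      ≡⟨ ℚP.+-identityˡ _ ⟩
    sumTo r (λ k → when (st ℕ.* k ℕ.+ st ≤ᵇ r) (g k (r ∸ (st ℕ.* k ℕ.+ st))))
      ≡⟨ sumTo-when-shift s st r r (λ st≤r → ℕP.∸-monoʳ-< (s≤s ℕ.z≤n) st≤r) g ⟩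
    when (st ≤ᵇ r) (sumTo (suc (r ∸ st)) (λ k → when (st ℕ.* k ≤ᵇ r ∸ st) (g k (r ∸ st ∸ st ℕ.* k))))
      ≡⟨ cong (when (st ≤ᵇ r)) (sym factor-t) ⟩
    when (st ≤ᵇ r) (t st * sumTo (suc (r ∸ st)) (λ k → when (st ℕ.* k ≤ᵇ r ∸ st) (pFactor st k * Q′ (r ∸ st ∸ st ℕ.* k))))
      ≡⟨ cong (λ z → when (st ≤ᵇ r) (t st * z)) (sym (pPartial-suc st len (r ∸ st))) ⟩
    when (st ≤ᵇ r) (t st * pPartial st (suc len) (r ∸ st)) ∎
    where
    st = suc s
    Q′ = pPartial (suc st) len
    fA = λ k → when (st ℕ.* k ≤ᵇ r) ((fromℕ (st ℕ.* k) * pFactor st k) * Q′ (r ∸ st ℕ.* k))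
    g = λ k v → (t st * pFactor st k) * Q′ v
    fA-0 : fA 0 ≡ 0ℚ
    fA-0 = trans (cong (λ m → when (m ≤ᵇ r) ((fromℕ m * pFactor st 0) * Q′ (r ∸ m))) (ℕP.*-zeroʳ st))
                 (trans (cong (when (0 ≤ᵇ r)) (trans (cong (_* Q′ r) (ℚP.*-zeroˡ (pFactor st 0))) (ℚP.*-zeroˡ (Q′ r))))
                        (when-0 (0 ≤ᵇ r)))
    fA-suc : ∀ k → fA (suc k) ≡ when (st ℕ.* k ℕ.+ st ≤ᵇ r) (g k (r ∸ (st ℕ.* k ℕ.+ st)))
    fA-suc k = trans (cong (λ z → when (st ℕ.* suc k ≤ᵇ r) (z * Q′ (r ∸ st ℕ.* suc k))) (fromℕ-*-pFactor s k))
                     (cong (λ m → when (m ≤ᵇ r) (g k (r ∸ m))) (trans (ℕP.*-suc st k) (ℕP.+-comm st (st ℕ.* k))))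
    factor-t : t st * sumTo (suc (r ∸ st)) (λ k → when (st ℕ.* k ≤ᵇ r ∸ st) (pFactor st k * Q′ (r ∸ st ∸ st ℕ.* k)))
               ≡ sumTo (suc (r ∸ st)) (λ k → when (st ℕ.* k ≤ᵇ r ∸ st) (g k (r ∸ st ∸ st ℕ.* k)))
    factor-t = trans (sumTo-*ˡ (suc (r ∸ st)) (t st) _) (sumTo-cong (suc (r ∸ st)) (λ k →
                 trans (*-when (st ℕ.* k ≤ᵇ r ∸ st) (t st) _)
                       (cong (when (st ℕ.* k ≤ᵇ r ∸ st)) (sym (ℚP.*-assoc (t st) (pFactor st k) _)))))

  -- The remaining summands, via Newton's recurrence for the later variables inside each k-term.
  pPartial-newton-rest : ∀ s len r →
    (∀ r → fromℕ r * pPartial (suc (suc s)) len r ≡ sumTo len (newtonTerm (suc (suc s)) len r)) →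
    sumTo (suc r) (λ k → when (suc s ℕ.* k ≤ᵇ r)
                             (pFactor (suc s) k * (fromℕ (r ∸ suc s ℕ.* k) * pPartial (suc (suc s)) len (r ∸ suc s ℕ.* k))))
      ≡ sumTo len (λ l → newtonTerm (suc s) (suc len) r (suc l))
  pPartial-newton-rest s len r newton-later = begin
    sumTo (suc r) fB             ≡⟨ sumTo-cong (suc r) fB-expand ⟩
    sumTo (suc r) (λ k → sumTo len (F k))  ≡⟨ sumTo-swap (suc r) len F ⟩
    sumTo len (λ l → sumTo (suc r) (λ k → F k l))  ≡⟨ sym (sumTo-cong len term-expand) ⟩
    sumTo len (λ l → newtonTerm st (suc len) r (suc l)) ∎
    where
    st = suc s
    Q′ = pPartial (suc st) len
    c = pFactor st
    fB = λ k → when (st ℕ.* k ≤ᵇ r) (c k * (fromℕ (r ∸ st ℕ.* k) * Q′ (r ∸ st ℕ.* k)))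
    F : ℕ → ℕ → ℚ
    F k l = when (st ℕ.* k ℕ.+ (suc st ℕ.+ l) ≤ᵇ r) (c k * (t (suc st ℕ.+ l) * Q′ (r ∸ (st ℕ.* k ℕ.+ (suc st ℕ.+ l)))))
    fB-expand : ∀ k → fB k ≡ sumTo len (F k)
    fB-expand k = begin
      when (st ℕ.* k ≤ᵇ r) (c k * (fromℕ r′ * Q′ r′))
        ≡⟨ cong (λ z → when (st ℕ.* k ≤ᵇ r) (c k * z)) (newton-later r′) ⟩
      when (st ℕ.* k ≤ᵇ r) (c k * sumTo len (newtonTerm (suc st) len r′))
        ≡⟨ cong (when (st ℕ.* k ≤ᵇ r)) (sumTo-*ˡ len (c k) _) ⟩
      when (st ℕ.* k ≤ᵇ r) (sumTo len (λ l → c k * newtonTerm (suc st) len r′ l))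
        ≡⟨ when-sumTo (st ℕ.* k ≤ᵇ r) len _ ⟩
      sumTo len (λ l → when (st ℕ.* k ≤ᵇ r) (c k * newtonTerm (suc st) len r′ l))
        ≡⟨ sumTo-cong len (λ l → trans (cong (when (st ℕ.* k ≤ᵇ r)) (nested l)) (when-when (st ℕ.* k) (suc st ℕ.+ l) r _)) ⟩
      sumTo len (F k) ∎
      where
      r′ = r ∸ st ℕ.* k
      nested : ∀ l → c k * newtonTerm (suc st) len r′ l
                     ≡ when (suc st ℕ.+ l ≤ᵇ r′) (c k * (t (suc st ℕ.+ l) * Q′ (r ∸ (st ℕ.* k ℕ.+ (suc st ℕ.+ l)))))
      nested l = trans (*-when (suc st ℕ.+ l ≤ᵇ r′) (c k) _)
        (cong (λ m → when (suc st ℕ.+ l ≤ᵇ r′) (c k * (t (suc st ℕ.+ l) * Q′ m))) (ℕP.∸-+-assoc r (st ℕ.* k) (suc st ℕ.+ l)))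
    term-expand : ∀ l → newtonTerm st (suc len) r (suc l) ≡ sumTo (suc r) (λ k → F k l)
    term-expand l = begin
      when (st ℕ.+ suc l ≤ᵇ r) (t (st ℕ.+ suc l) * pPartial st (suc len) (r ∸ (st ℕ.+ suc l)))
        ≡⟨ cong (λ m → when (m ≤ᵇ r) (t m * pPartial st (suc len) (r ∸ m))) (ℕP.+-suc st l) ⟩
      when (i ≤ᵇ r) (t i * pPartial st (suc len) (r ∸ i))
        ≡⟨ cong (λ z → when (i ≤ᵇ r) (t i * z)) (pPartial-suc st len (r ∸ i)) ⟩
      when (i ≤ᵇ r) (t i * sumTo (suc (r ∸ i)) (λ k → when (st ℕ.* k ≤ᵇ r ∸ i) (c k * Q′ (r ∸ i ∸ st ℕ.* k))))
        ≡⟨ cong (when (i ≤ᵇ r)) (trans (sumTo-*ˡ (suc (r ∸ i)) (t i) _)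
             (sumTo-cong (suc (r ∸ i)) (λ k → *-when (st ℕ.* k ≤ᵇ r ∸ i) (t i) _))) ⟩
      when (i ≤ᵇ r) (sumTo (suc (r ∸ i)) (λ k → when (st ℕ.* k ≤ᵇ r ∸ i) (g k (r ∸ i ∸ st ℕ.* k))))
        ≡⟨ sym (sumTo-when-shift s i r (suc r) (λ _ → s≤s (ℕP.m∸n≤m r i)) g) ⟩
      sumTo (suc r) (λ k → when (st ℕ.* k ℕ.+ i ≤ᵇ r) (g k (r ∸ (st ℕ.* k ℕ.+ i))))
        ≡⟨ sumTo-cong (suc r) (λ k → cong (when (st ℕ.* k ℕ.+ i ≤ᵇ r))
             (solve 3 (λ a c q → a :* (c :* q) := c :* (a :* q)) refl (t i) (c k) (Q′ (r ∸ (st ℕ.* k ℕ.+ i))))) ⟩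
      sumTo (suc r) (λ k → F k l) ∎
      where
      i = suc st ℕ.+ l
      g = λ k v → t i * (c k * Q′ v)

  pPartial-newton : ∀ len s r → fromℕ r * pPartial (suc s) len r ≡ sumTo len (newtonTerm (suc s) len r)
  pPartial-newton zero      s zero    = ℚP.*-zeroˡ (pPartial (suc s) 0 0)
  pPartial-newton zero      s (suc r) = ℚP.*-zeroʳ (fromℕ (suc r))
  pPartial-newton (suc len) s r = begin
    fromℕ r * pPartial st (suc len) r
      ≡⟨ cong (fromℕ r *_) (pPartial-suc st len r) ⟩
    fromℕ r * sumTo (suc r) (λ k → when (b k) (c k * Q′ (r ∸ st ℕ.* k)))
      ≡⟨ sumTo-*ˡ (suc r) (fromℕ r) _ ⟩
    sumTo (suc r) (λ k → fromℕ r * when (b k) (c k * Q′ (r ∸ st ℕ.* k)))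
      ≡⟨ sumTo-cong (suc r) split-degree ⟩
    sumTo (suc r) (λ k → fA k + fB k)
      ≡⟨ sumTo-+ (suc r) fA fB ⟩
    sumTo (suc r) fA + sumTo (suc r) fB
      ≡⟨ cong₂ _+_ (pPartial-newton-first s len r) (pPartial-newton-rest s len r (pPartial-newton len (suc s))) ⟩
    when (st ≤ᵇ r) (t st * pPartial st (suc len) (r ∸ st)) + sumTo len (λ l → newtonTerm st (suc len) r (suc l))
      ≡⟨ cong (_+ sumTo len (λ l → newtonTerm st (suc len) r (suc l)))
              (cong (λ m → when (m ≤ᵇ r) (t m * pPartial st (suc len) (r ∸ m))) (sym (ℕP.+-identityʳ st))) ⟩
    newtonTerm st (suc len) r 0 + sumTo len (λ l → newtonTerm st (suc len) r (suc l))
      ≡⟨ sym (sumTo-suc len (newtonTerm st (suc len) r)) ⟩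
    sumTo (suc len) (newtonTerm st (suc len) r) ∎
    where
    st = suc s
    Q′ = pPartial (suc st) len
    c = pFactor st
    b = λ k → st ℕ.* k ≤ᵇ r
    fA = λ k → when (b k) ((fromℕ (st ℕ.* k) * c k) * Q′ (r ∸ st ℕ.* k))
    fB = λ k → when (b k) (c k * (fromℕ (r ∸ st ℕ.* k) * Q′ (r ∸ st ℕ.* k)))
    -- r = st·k + (r ∸ st·k) on the support of the guard
    split-degree : ∀ k → fromℕ r * when (b k) (c k * Q′ (r ∸ st ℕ.* k)) ≡ fA k + fB k
    split-degree k = trans (*-when (b k) (fromℕ r) _) (trans (when-cong (b k) (λ st·k≤r →
      trans (cong (_* (c k * Q′ (r ∸ st ℕ.* k)))
                  (trans (cong fromℕ (sym (ℕP.m+[n∸m]≡n (ℕP.≤ᵇ⇒≤ (st ℕ.* k) r st·k≤r))))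
                         (fromℕ-+ (st ℕ.* k) (r ∸ st ℕ.* k))))
            (solve 4 (λ A B c q → (A :+ B) :* (c :* q) := (A :* c) :* q :+ c :* (B :* q)) refl
               (fromℕ (st ℕ.* k)) (fromℕ (r ∸ st ℕ.* k)) (c k) (Q′ (r ∸ st ℕ.* k)))))
      (when-+ (b k) _ _))

pPartial-newtonRecurrence : ∀ t M → NewtonRecurrence t (pPartial t 1 M) M
pPartial-newtonRecurrence t M r r≤M = begin
  fromℕ r * pPartial t 1 M r
    ≡⟨ pPartial-newton t M 0 r ⟩
  sumTo M (newtonTerm t 1 M r)
    ≡⟨ sumTo-vanishing-tail r M _ r≤M (λ l r≤l → when-≰ _ (λ 1+l≤r → ℕP.<-irrefl refl (ℕP.≤-trans 1+l≤r r≤l))) ⟩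
  sumTo r (newtonTerm t 1 M r)
    ≡⟨ sumTo-cong-< r (λ i i<r → when-≤ _ i<r) ⟩
  sumTo r (λ i → t (suc i) * pPartial t 1 M (r ∸ suc i)) ∎

hom≡P : ∀ n q → hom 0 n (suc q) ≡ P (suc q) (λ i → H n i)
hom≡P n q = sym (newtonRecurrence-unique {t = H n} base (pPartial-newtonRecurrence (H n) (suc q)) (λ r _ → hom-newton 0 n r)
                                         (suc q) ℕP.≤-refl)
  where
  base : pPartial (H n) 1 (suc q) 0 ≡ hom 0 n 0
  base = trans (pPartial-zero-degree (H n) 0 (suc q)) (sym (hom-zero-degree 0 n))

-- Convergence

*-mono-≤-nonNeg : ∀ {a b c d} → 0ℚ ℚ.≤ a → a ℚ.≤ b → 0ℚ ℚ.≤ c → c ℚ.≤ d → a * c ℚ.≤ b * d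
*-mono-≤-nonNeg {a} {b} {c} {d} 0≤a a≤b 0≤c c≤d =
  ℚP.≤-trans (ℚP.*-monoʳ-≤-nonNeg c {{nonNegative 0≤c}} a≤b)
             (ℚP.*-monoˡ-≤-nonNeg b {{nonNegative (ℚP.≤-trans 0≤a a≤b)}} c≤d)

*-nonNeg : ∀ {a b} → 0ℚ ℚ.≤ a → 0ℚ ℚ.≤ b → 0ℚ ℚ.≤ a * b
*-nonNeg {a} {b} 0≤a 0≤b =
  ℚP.nonNegative⁻¹ (a * b) {{ℚP.nonNeg*nonNeg⇒nonNeg a {{nonNegative 0≤a}} b {{nonNegative 0≤b}}}}

^ℚ-nonNeg : ∀ {a} k → 0ℚ ℚ.≤ a → 0ℚ ℚ.≤ a ^ℚ k
^ℚ-nonNeg zero    _   = ℚP.<⇒≤ (ℚP.positive⁻¹ 1ℚ)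
^ℚ-nonNeg (suc k) 0≤a = *-nonNeg 0≤a (^ℚ-nonNeg k 0≤a)

^ℚ-mono-≤ : ∀ {a b} k → 0ℚ ℚ.≤ a → a ℚ.≤ b → a ^ℚ k ℚ.≤ b ^ℚ k
^ℚ-mono-≤ zero    _   _   = ℚP.≤-refl
^ℚ-mono-≤ (suc k) 0≤a a≤b = *-mono-≤-nonNeg 0≤a a≤b (^ℚ-nonNeg k 0≤a) (^ℚ-mono-≤ k 0≤a a≤b)

sumTo-mono-≤ : ∀ N {f g : ℕ → ℚ} → (∀ i → f i ℚ.≤ g i) → sumTo N f ℚ.≤ sumTo N g
sumTo-mono-≤ zero    f≤g = ℚP.≤-refl
sumTo-mono-≤ (suc N) f≤g = ℚP.+-mono-≤ (sumTo-mono-≤ N f≤g) (f≤g N)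

sumTo-nonNeg : ∀ N {f : ℕ → ℚ} → (∀ i → 0ℚ ℚ.≤ f i) → 0ℚ ℚ.≤ sumTo N f
sumTo-nonNeg N {f} 0≤f = subst (ℚ._≤ sumTo N f) (sumTo-zero N) (sumTo-mono-≤ N 0≤f)

compSum-nonNeg : ∀ j k p → 0ℚ ℚ.≤ compSum j k p
compSum-nonNeg j zero    zero    = ℚP.<⇒≤ (ℚP.positive⁻¹ 1ℚ)
compSum-nonNeg j zero    (suc p) = ℚP.≤-refl
compSum-nonNeg j (suc k) p       =
  sumTo-nonNeg (suc p) (λ a → *-nonNeg (^ℚ-nonNeg (suc a) (recip-nonNeg j)) (compSum-nonNeg (suc j) k (p ∸ a)))

compSum-antitone : ∀ {i j} k p → i ℕ.≤ j → compSum j k p ℚ.≤ compSum i k p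
compSum-antitone {i} {j} zero    p _   = ℚP.≤-reflexive (compSum-zero-parts j i p)
compSum-antitone {i} {j} (suc k) p i≤j = sumTo-mono-≤ (suc p) (λ a →
  *-mono-≤-nonNeg (^ℚ-nonNeg (suc a) (recip-nonNeg j)) (^ℚ-mono-≤ (suc a) (recip-nonNeg j) (recip-antitone i≤j))
                  (compSum-nonNeg (suc j) k (p ∸ a)) (compSum-antitone k (p ∸ a) (s≤s i≤j)))

compSum-decay : ∀ j k p → compSum j (suc k) p ℚ.≤ recip j * (compSum 0 k p + compSum⁻ 0 (suc k) p)
compSum-decay j k p = ℚP.≤-trans (ℚP.≤-reflexive (compSum-first j k p))
  (ℚP.*-monoˡ-≤-nonNeg (recip j) {{nonNegative (recip-nonNeg j)}}
    (ℚP.+-mono-≤ (compSum-antitone {0} {suc j} k p ℕ.z≤n) (shifted p)))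
  where
  shifted : ∀ p → compSum⁻ j (suc k) p ℚ.≤ compSum⁻ 0 (suc k) p
  shifted zero    = ℚP.≤-refl
  shifted (suc p) = compSum-antitone {0} {j} (suc k) p ℕ.z≤n

convergesTo-cong : ∀ {a b : ℕ → ℚ} {L} → (∀ M → a M ≡ b M) → ConvergesTo b L → ConvergesTo a L
convergesTo-cong {L = L} a≗b b→L ε 0<ε with b→L ε 0<ε
... | N , close = N , λ M N≤M → subst (λ z → ∣ z - L ∣ ℚ.< ε) (sym (a≗b M)) (close M N≤M)

convergesTo-sub-vanishing : ∀ L K (b : ℕ → ℚ) → (∀ M → 0ℚ ℚ.≤ b M) → (∀ M → b M ℚ.≤ recip M * K) →
  ConvergesTo (λ M → L - b M) L
convergesTo-sub-vanishing L K b 0≤b b≤K/M ε 0<ε with archimedean K ε 0<ε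
... | N , K<εN = N , λ M N≤M → ℚP.≤-<-trans (ℚP.≤-reflexive (distance M))
  (ℚP.≤-<-trans (b≤K/M M) (ℚP.≤-<-trans (ℚP.*-monoʳ-≤-nonNeg K {{nonNegative 0≤K}} (recip-antitone N≤M)) K/N<ε))
  where
  distance : ∀ M → ∣ (L - b M) - L ∣ ≡ b M
  distance M = trans (cong ∣_∣ (solve 2 (λ l b → (l :- b) :- l := :- b) refl L (b M)))
                     (trans (ℚP.∣-p∣≡∣p∣ (b M)) (ℚP.0≤p⇒∣p∣≡p (0≤b M)))
  0≤K : 0ℚ ℚ.≤ K
  0≤K = ℚP.≤-trans (0≤b 0) (ℚP.≤-trans (b≤K/M 0) (ℚP.≤-reflexive (ℚP.*-identityˡ K)))
  K/N<ε : recip N * K ℚ.< ε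
  K/N<ε = ℚP.<-≤-trans (ℚP.*-monoʳ-<-pos (recip N) {{positive (recip-pos N)}} K<εN)
    (ℚP.≤-reflexive (trans (solve 3 (λ r e n → r :* (e :* n) := e :* (r :* n)) refl (recip N) ε (fromℕ (suc N)))
                           (trans (cong (ε *_) (recip-*-fromℕ N)) (ℚP.*-identityʳ ε))))

limit≡P : ∀ m q → recip m * compSum 0 (suc m) (suc q) ≡ P (suc q) (λ i → H (suc m) i) * (recip m * invFact (suc m))
limit≡P m q = begin
  recip m * compSum 0 (suc m) (suc q)
    ≡⟨ cong (recip m *_) (compSum≡recipProd*hom 0 (suc m) (suc q)) ⟩
  recip m * (recipProd 0 (suc m) * hom 0 (suc m) (suc q))
    ≡⟨ cong₂ (λ a b → recip m * (a * b)) (recipProd-zero≡invFact (suc m)) (hom≡P (suc m) q) ⟩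
  recip m * (invFact (suc m) * P (suc q) (λ i → H (suc m) i))
    ≡⟨ solve 3 (λ u f p → u :* (f :* p) := p :* (u :* f)) refl (recip m) (invFact (suc m)) _ ⟩
  P (suc q) (λ i → H (suc m) i) * (recip m * invFact (suc m)) ∎

theorem3p2 : (n q : ℕ) → 1 ≤ n →
    ConvergesTo (lhsPartial n q)
    (P (suc q) (λ i → H n i) * (recip (n ∸ 1) * invFact n))
theorem3p2 zero    q ()
theorem3p2 (suc m) q _ =
  subst (ConvergesTo (lhsPartial (suc m) q)) (limit≡P m q)
    (convergesTo-cong (lhsPartial-telescopes m q)
      (convergesTo-sub-vanishing (recip m * compSum 0 (suc m) (suc q)) (recip m * C) tail tail-nonNeg tail≤C/N))
  where
  C = compSum 0 m (suc q) + compSum⁻ 0 (suc m) (suc q)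
  tail : ℕ → ℚ
  tail N = recip m * compSum N (suc m) (suc q)
  tail-nonNeg : ∀ N → 0ℚ ℚ.≤ tail N
  tail-nonNeg N = *-nonNeg (recip-nonNeg m) (compSum-nonNeg N (suc m) (suc q))
  tail≤C/N : ∀ N → tail N ℚ.≤ recip N * (recip m * C)
  tail≤C/N N = ℚP.≤-trans (ℚP.*-monoˡ-≤-nonNeg (recip m) {{nonNegative (recip-nonNeg m)}} (compSum-decay N m (suc q)))
    (ℚP.≤-reflexive (solve 3 (λ u v c → u :* (v :* c) := v :* (u :* c)) refl (recip m) (recip N) C))
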